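{- Let $t$ be an integer with $t^2+4 = dz^2$ for some integer $z$ and some $d\in\{1,2,3,6\}$, and suppose $\omega = (t+\sqrt{t^2+4})/2$ is the fundamental unit of the quadratic field $\mathbb{Q}(\sqrt{t^2+4})$. Then the curve $E: y^2 = d^2(t^2+4)x^4 - 4$ has no integral solution $(x,y)\in\mathbb{Z}^2$. -}

module Defs where

open import Data.Nat using (ℕ; zero; suc)
open import Data.Integer using (ℤ; +_)
open import Data.Rational using (ℚ; _/_; 0ℚ; 1ℚ; _+_; _*_; -_; _-_; _<_; _≤_)
open import Data.Product using (_×_; _,_; ∃-syntax)
open import Data.Sum using (_⊎_)
open import Relation.Binary.PropositionalEquality using (_≡_)

-- Elements of Q(√D) (D a fixed positive integer, not a square in the
-- cases of interest) written as  p + q √D  with p q : ℚ.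
record QD : Set where
  constructor ⟨_+_√⟩
  field
    re : ℚ
    im : ℚ
open QD public

ι : ℤ → ℚ
ι k = k / 1

module _ (D : ℤ) where

  mulD : QD → QD → QD
  mulD ⟨ p + q √⟩ ⟨ p' + q' √⟩ = ⟨ ((p * p') + (ι D * (q * q'))) + ((p * q') + (q * p')) √⟩

  oneD : QD
  oneD = ⟨ 1ℚ + 0ℚ √⟩

  negD : QD → QD
  negD ⟨ p + q √⟩ = ⟨ (- p) + (- q) √⟩

  powD : QD → ℕ → QD
  powD u zero    = oneD
  powD u (suc n) = mulD u (powD u n)

  normD : QD → ℚ
  normD ⟨ p + q √⟩ = (p * p) - (ι D * (q * q))

  -- u is a unit of the ring of integers of Q(√D): u is an algebraic
  -- integer (its characteristic polynomial X² − 2pX + N(u) has integer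
  -- coefficients) and N(u) = ±1.
  IsUnitD : QD → Set
  IsUnitD u = (∃[ k ] ((ι (+ 2) * re u) ≡ ι k))
            × ((normD u ≡ 1ℚ) ⊎ (normD u ≡ - 1ℚ))

  -- the real number p + q√D (√D the positive square root, D > 0) exceeds 1,
  -- i.e. q√D > 1 − p, written out with rational comparisons.
  GreaterThanOneD : QD → Set
  GreaterThanOneD ⟨ p + q √⟩ =
      (0ℚ < q × ((r < 0ℚ) ⊎ ((r * r) < (ι D * (q * q)))))
    ⊎ (q ≤ 0ℚ × (r < 0ℚ) × ((ι D * (q * q)) < (r * r)))
    where r = 1ℚ - p

  -- ω is the fundamental unit: a unit, greater than 1, such that every
  -- unit is ± ω^n for some integer n (n ≥ 0: u = ±ωⁿ; n < 0: u·ω^|n| = ±1).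
  IsFundamentalUnitD : QD → Set
  IsFundamentalUnitD ω =
      IsUnitD ω × GreaterThanOneD ω
    × (∀ u → IsUnitD u → ∃[ n ]
         ((u ≡ powD ω n) ⊎ (u ≡ negD (powD ω n))
          ⊎ (mulD u (powD ω n) ≡ oneD) ⊎ (mulD u (powD ω n) ≡ negD oneD)))

{-# OPTIONS --safe #-}
module Submission where

-- For d = 3 and d = 6 the hypothesis t² + 4 = d z² already fails modulo 3,
-- since no square is ≡ 2 (mod 3). For d = 1 it forces t = 0, because 0 and 4
-- are the only squares differing by 4; then ω = 1, which is not greater than 1.
-- For d = 2 it forces t to be even, so 16 ∣ d²(t² + 4), and a point on the
-- curve would give y² ≡ -4 (mod 16), which no square satisfies.

module _ where
  open import Data.Fin using (Fin; toℕ)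
  open import Data.Fin.Properties using (all?; toℕ-fromℕ<)
  open import Data.Nat using (zero; suc; _+_; _*_; _∸_; _≤_; _≤?_; NonZero; z≤n; s≤s)
  open import Data.Nat.Properties
  open import Data.Nat.DivMod using (_%_; _mod_; %-distribˡ-+; %-distribˡ-*; m%n<n)
  open import Data.Nat.Divisibility
  open import Data.Nat.Primality using (Prime; prime[2]; euclidsLemma)
  open import Data.Nat.Tactic.RingSolver using (solve-∀)
  open import Data.Empty using (⊥-elim)
  open import Data.Sum using (reduce)
  open import Relation.Nullary using (yes; no; contradiction)
  open import Relation.Nullary.Decidable using (from-yes; ¬?)
  open import Relation.Binary.PropositionalEquality using (_≡_; refl; sym; trans; cong; subst; module ≡-Reasoning)

  [n*n+c]%m≡[r*r+c]%m : ∀ m c n .{{_ : NonZero m}} →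
    (n * n + c) % m ≡ (toℕ (n mod m) * toℕ (n mod m) + c) % m
  [n*n+c]%m≡[r*r+c]%m m c n = begin
    (n * n + c) % m                     ≡⟨ %-distribˡ-+ (n * n) c m ⟩
    ((n * n) % m + c % m) % m           ≡⟨ cong (λ k → (k + c % m) % m) (%-distribˡ-* n n m) ⟩
    ((n % m * (n % m)) % m + c % m) % m ≡⟨ %-distribˡ-+ (n % m * (n % m)) c m ⟨
    (n % m * (n % m) + c) % m           ≡⟨ cong (λ r → (r * r + c) % m) (toℕ-fromℕ< (m%n<n n m)) ⟨
    (toℕ (n mod m) * toℕ (n mod m) + c) % m ∎
    where open ≡-Reasoning

  residues⇒∤n*n+c : ∀ m c .{{_ : NonZero m}} →
    (∀ (r : Fin m) → m ∤ toℕ r * toℕ r + c) → ∀ n → m ∤ n * n + c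
  residues⇒∤n*n+c m c m∤r*r+c n m∣n*n+c = m∤r*r+c (n mod m) (m%n≡0⇒n∣m _ m
    (trans (sym ([n*n+c]%m≡[r*r+c]%m m c n)) (n∣m⇒m%n≡0 _ m m∣n*n+c)))

  3∤n*n+4 : ∀ n → 3 ∤ n * n + 4
  3∤n*n+4 = residues⇒∤n*n+c 3 4
    (from-yes (all? λ (r : Fin 3) → ¬? (3 ∣? toℕ r * toℕ r + 4)))

  16∤n*n+4 : ∀ n → 16 ∤ n * n + 4
  16∤n*n+4 = residues⇒∤n*n+c 16 4
    (from-yes (all? λ (r : Fin 16) → ¬? (16 ∣? toℕ r * toℕ r + 4)))

  prime∣n*n⇒∣n : ∀ {p} n → Prime p → p ∣ n * n → p ∣ n
  prime∣n*n⇒∣n n p-prime p∣n*n = reduce (euclidsLemma n n p-prime p∣n*n)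

  2∣n*n+4⇒16∣4*[n*n+4] : ∀ n → 2 ∣ n * n + 4 → 16 ∣ 4 * (n * n + 4)
  2∣n*n+4⇒16∣4*[n*n+4] n 2∣n*n+4 = *-monoʳ-∣ 4 (∣m∣n⇒∣m+n (*-pres-∣ 2∣n 2∣n) ∣-refl)
    where
    2∣n*n : 2 ∣ n * n
    2∣n*n = ∣m+n∣m⇒∣n (subst (2 ∣_) (+-comm (n * n) 4) 2∣n*n+4) (divides 2 refl)

    2∣n : 2 ∣ n
    2∣n = prime∣n*n⇒∣n n prime[2] 2∣n*n

  c*[c+2n]-mono-≤ : ∀ {c₀ c n₀ n} → c₀ ≤ c → n₀ ≤ n → c₀ * (c₀ + 2 * n₀) ≤ c * (c + 2 * n)
  c*[c+2n]-mono-≤ c₀≤c n₀≤n = *-mono-≤ c₀≤c (+-mono-≤ c₀≤c (*-monoʳ-≤ 2 n₀≤n))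

  c*[c+2n]≡4⇒n≡0 : ∀ c n → c * (c + 2 * n) ≡ 4 → n ≡ 0
  c*[c+2n]≡4⇒n≡0 _             zero          _  = refl
  c*[c+2n]≡4⇒n≡0 zero          (suc _)       ()
  c*[c+2n]≡4⇒n≡0 1             1             ()
  c*[c+2n]≡4⇒n≡0 1             (suc (suc n)) eq =
    ⊥-elim (<-irrefl (sym eq) (c*[c+2n]-mono-≤ (≤-refl {1}) (s≤s (s≤s (z≤n {n})))))
  c*[c+2n]≡4⇒n≡0 (suc (suc c)) (suc n)       eq =
    ⊥-elim (<-irrefl (sym eq) (≤-trans (m≤m+n 5 3) (c*[c+2n]-mono-≤ (m≤m+n 2 c) (s≤s (z≤n {n})))))

  n*n+4≡m*m⇒n≡0 : ∀ n m → n * n + 4 ≡ m * m → n ≡ 0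
  n*n+4≡m*m⇒n≡0 n m eq = c*[c+2n]≡4⇒n≡0 (m ∸ n) n (+-cancelˡ-≡ (n * n) _ _ (begin
    n * n + (m ∸ n) * ((m ∸ n) + 2 * n)     ≡⟨ square-expand n (m ∸ n) ⟨
    (n + (m ∸ n)) * (n + (m ∸ n))           ≡⟨ cong (λ k → k * k) (m+[n∸m]≡n n≤m) ⟩
    m * m                                   ≡⟨ eq ⟨
    n * n + 4                               ∎))
    where
    open ≡-Reasoning

    square-expand : ∀ a c → (a + c) * (a + c) ≡ a * a + c * (c + 2 * a)
    square-expand = solve-∀

    n≤m : n ≤ m
    n≤m with n ≤? m
    ... | yes n≤m = n≤m
    ... | no  n≰m = contradiction (subst (n * n ≤_) eq (m≤m+n (n * n) 4))
                                  (<⇒≱ (*-mono-< (≰⇒> n≰m) (≰⇒> n≰m)))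

open import Defs
open import Data.Integer using (ℤ; +_; _+_; _*_; _-_; _^_; ∣_∣; sign; _◃_; +<+; +≤+)
import Data.Integer.Properties as ℤ
open import Algebra.Properties.AbelianGroup ℤ.+-0-abelianGroup using (//-rightDividesˡ)
import Data.Nat as ℕ
import Data.Nat.Properties as ℕ
open import Data.Nat.Divisibility using (_∣_; divides; ∣-trans)
open import Data.Product using (_,_; ∃-syntax; ∄-syntax)
open import Data.Rational using (_/_)
import Data.Rational as ℚ
import Data.Rational.Properties as ℚ
import Data.Sign as Sign
open import Data.Sign.Properties using (s*s≡+)
open import Data.Sum using (_⊎_; inj₁; inj₂)
open import Relation.Nullary using (¬_)
open import Relation.Binary.PropositionalEquality using (_≡_; refl; trans; cong; cong₂; subst; module ≡-Reasoning)

i^2≡+∣i∣*∣i∣ : ∀ i → i ^ 2 ≡ + (∣ i ∣ ℕ.* ∣ i ∣)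
i^2≡+∣i∣*∣i∣ i = begin
  i * (i * + 1)             ≡⟨ cong (i *_) (ℤ.*-identityʳ i) ⟩
  i * i                     ≡⟨ cong (_◃ ∣ i ∣ ℕ.* ∣ i ∣) (s*s≡+ (sign i)) ⟩
  Sign.+ ◃ ∣ i ∣ ℕ.* ∣ i ∣  ≡⟨ ℤ.+◃n≡+n _ ⟩
  + (∣ i ∣ ℕ.* ∣ i ∣)       ∎
  where open ≡-Reasoning

∣i^2+n∣≡∣i∣*∣i∣+n : ∀ i n → ∣ i ^ 2 + + n ∣ ≡ ∣ i ∣ ℕ.* ∣ i ∣ ℕ.+ n
∣i^2+n∣≡∣i∣*∣i∣+n i n = cong (λ j → ∣ j + + n ∣) (i^2≡+∣i∣*∣i∣ i)

abs-t^2+4≡d*z^2 : ∀ t d z → t ^ 2 + + 4 ≡ d * z ^ 2 →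
  ∣ t ∣ ℕ.* ∣ t ∣ ℕ.+ 4 ≡ ∣ d ∣ ℕ.* (∣ z ∣ ℕ.* ∣ z ∣)
abs-t^2+4≡d*z^2 t d z eq = begin
  ∣ t ∣ ℕ.* ∣ t ∣ ℕ.+ 4        ≡⟨ ∣i^2+n∣≡∣i∣*∣i∣+n t 4 ⟨
  ∣ t ^ 2 + + 4 ∣              ≡⟨ cong ∣_∣ eq ⟩
  ∣ d * z ^ 2 ∣                ≡⟨ ℤ.abs-* d (z ^ 2) ⟩
  ∣ d ∣ ℕ.* ∣ z ^ 2 ∣          ≡⟨ cong (λ j → ∣ d ∣ ℕ.* ∣ j ∣) (i^2≡+∣i∣*∣i∣ z) ⟩
  ∣ d ∣ ℕ.* (∣ z ∣ ℕ.* ∣ z ∣)  ∎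
  where open ≡-Reasoning

t^2+4≡d*z^2⇒∣d∣∣∣t∣*∣t∣+4 : ∀ t d z → t ^ 2 + + 4 ≡ d * z ^ 2 → ∣ d ∣ ∣ ∣ t ∣ ℕ.* ∣ t ∣ ℕ.+ 4
t^2+4≡d*z^2⇒∣d∣∣∣t∣*∣t∣+4 t d z eq =
  divides (∣ z ∣ ℕ.* ∣ z ∣) (trans (abs-t^2+4≡d*z^2 t d z eq) (ℕ.*-comm ∣ d ∣ _))

curve-point⇒d^2[t^2+4]∣y^2+4 : ∀ t d x y → y ^ 2 ≡ ((d ^ 2) * ((t ^ 2) + + 4)) * (x ^ 4) - + 4 →
  ∣ d ∣ ℕ.* ∣ d ∣ ℕ.* (∣ t ∣ ℕ.* ∣ t ∣ ℕ.+ 4) ∣ ∣ y ∣ ℕ.* ∣ y ∣ ℕ.+ 4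
curve-point⇒d^2[t^2+4]∣y^2+4 t d x y eq = divides ∣ x ^ 4 ∣ (begin
  ∣ y ∣ ℕ.* ∣ y ∣ ℕ.+ 4                        ≡⟨ ∣i^2+n∣≡∣i∣*∣i∣+n y 4 ⟨
  ∣ y ^ 2 + + 4 ∣                              ≡⟨ cong (λ j → ∣ j + + 4 ∣) eq ⟩
  ∣ a * x ^ 4 - + 4 + + 4 ∣                    ≡⟨ cong ∣_∣ (//-rightDividesˡ (+ 4) (a * x ^ 4)) ⟩
  ∣ a * x ^ 4 ∣                                ≡⟨ ℤ.abs-* a (x ^ 4) ⟩
  ∣ d ^ 2 * (t ^ 2 + + 4) ∣ ℕ.* ∣ x ^ 4 ∣      ≡⟨ cong (ℕ._* ∣ x ^ 4 ∣) (ℤ.abs-* (d ^ 2) (t ^ 2 + + 4)) ⟩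
  ∣ d ^ 2 ∣ ℕ.* ∣ t ^ 2 + + 4 ∣ ℕ.* ∣ x ^ 4 ∣  ≡⟨ cong₂ (λ m n → m ℕ.* n ℕ.* ∣ x ^ 4 ∣)
                                                     (cong ∣_∣ (i^2≡+∣i∣*∣i∣ d)) (∣i^2+n∣≡∣i∣*∣i∣+n t 4) ⟩
  D ℕ.* ∣ x ^ 4 ∣                              ≡⟨ ℕ.*-comm D ∣ x ^ 4 ∣ ⟩
  ∣ x ^ 4 ∣ ℕ.* D                              ∎)
  where
  open ≡-Reasoning

  a : ℤ
  a = d ^ 2 * (t ^ 2 + + 4)

  D : ℕ.ℕ
  D = ∣ d ∣ ℕ.* ∣ d ∣ ℕ.* (∣ t ∣ ℕ.* ∣ t ∣ ℕ.+ 4)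

-- ω = 0 + ½√4 = 1: the three disjuncts reduce to 1 < 0, 1 < 1 and ½ ≤ 0.
¬GreaterThanOneD[½√4] : ¬ GreaterThanOneD (+ 4) ⟨ ℚ.0ℚ + ℚ.½ √⟩
¬GreaterThanOneD[½√4] (inj₁ (_ , inj₁ (ℚ.*<* (+<+ ()))))
¬GreaterThanOneD[½√4] (inj₁ (_ , inj₂ 1<1)) = ℚ.<-irrefl refl 1<1
¬GreaterThanOneD[½√4] (inj₂ (ℚ.*≤* (+≤+ ()) , _))

mainTheorem10 : (t d : ℤ)
    → ((d ≡ + 1) ⊎ (d ≡ + 2) ⊎ (d ≡ + 3) ⊎ (d ≡ + 6))
    → (∃[ z ] ((t ^ 2) + + 4 ≡ d * (z ^ 2)))
    → IsFundamentalUnitD ((t ^ 2) + + 4) ⟨ (t / 2) + (+ 1 / 2) √⟩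
    → ∄[ x ] ∃[ y ] ((y ^ 2) ≡ ((d ^ 2) * ((t ^ 2) + + 4)) * (x ^ 4) - + 4)
mainTheorem10 t _ (inj₁ refl) (z , t²+4≡z²) (_ , ω>1 , _) _ =
  ¬GreaterThanOneD[½√4]
    (subst (λ s → GreaterThanOneD (s ^ 2 + + 4) ⟨ (s / 2) + (+ 1 / 2) √⟩) t≡0 ω>1)
  where
  t≡0 : t ≡ + 0
  t≡0 = ℤ.∣i∣≡0⇒i≡0 (n*n+4≡m*m⇒n≡0 ∣ t ∣ ∣ z ∣
          (trans (abs-t^2+4≡d*z^2 t (+ 1) z t²+4≡z²) (ℕ.*-identityˡ _)))
mainTheorem10 t _ (inj₂ (inj₁ refl)) (z , t²+4≡2z²) _ (x , y , on-curve) =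
  16∤n*n+4 ∣ y ∣
    (∣-trans (2∣n*n+4⇒16∣4*[n*n+4] ∣ t ∣ (t^2+4≡d*z^2⇒∣d∣∣∣t∣*∣t∣+4 t (+ 2) z t²+4≡2z²))
             (curve-point⇒d^2[t^2+4]∣y^2+4 t (+ 2) x y on-curve))
mainTheorem10 t _ (inj₂ (inj₂ (inj₁ refl))) (z , t²+4≡3z²) _ _ =
  3∤n*n+4 ∣ t ∣ (t^2+4≡d*z^2⇒∣d∣∣∣t∣*∣t∣+4 t (+ 3) z t²+4≡3z²)
mainTheorem10 t _ (inj₂ (inj₂ (inj₂ refl))) (z , t²+4≡6z²) _ _ =
  3∤n*n+4 ∣ t ∣ (∣-trans (divides 2 refl) (t^2+4≡d*z^2⇒∣d∣∣∣t∣*∣t∣+4 t (+ 6) z t²+4≡6z²))
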